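{- Let $t$ be a term and $\vec{x} = (x_1,\dots,x_k)$ a list of pairwise distinct variables with $\mathrm{fv}(t)\subseteq\{x_1,\dots,x_k\}$. The following are equivalent: (1) $t$ is $\bar{\mathsf{sh}}$-normalizable and its $\bar{\mathsf{sh}}$-normal form is a value; (2) $((\mathbf{0},\dots,\mathbf{0}),\mathbf{0}) \in [\![t]\!]_{\vec{x}}$ (with $k$ copies of $\mathbf{0}$ in the tuple); (3) there is a type derivation with conclusion $\vdash t\colon\mathbf{0}$.
   Context: Terms: $t ::= x \mid \lambda x.t \mid tu$ up to $\alpha$-conversion; values are variables and abstractions. Balanced contexts: $B ::= [\cdot] \mid (\lambda x.B)t \mid Bt \mid tB$. Root rules: $(\lambda x.t)v \mapsto_{\beta_v} t\{v/x\}$ ($v$ value); $(\lambda x.t)us \mapsto_{\sigma_1} (\lambda x.ts)u$ if $x\notin\mathrm{fv}(s)$; $v((\lambda x.s)u) \mapsto_{\sigma_3} (\lambda x.vs)u$ if $v$ value and $x \notin \mathrm{fv}(v)$. $\to_{\bar{\mathsf{sh}}}$ is the closure of the union of these three root rules under balanced contexts; normal form, normalizable as usual. Types: negative $N ::= P\multimap Q$; positive $P,Q ::= [N_1,\dots,N_n]$ finite multisets ($n\ge0$), $\mathbf{0}$ the empty multiset. Environments: maps from variables to positive types, $\mathbf{0}$ almost everywhere; $\uplus$ pointwise multiset sum; $\vdash t\colon P$ means the environment is everywhere $\mathbf{0}$. Rules: (ax) $x\colon P\vdash x\colon P$; (@) from $\Gamma\vdash t\colon[P\multimap Q]$ and $\Gamma'\vdash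 u\colon P$ infer $\Gamma\uplus\Gamma'\vdash tu\colon Q$; ($\lambda$) for $n\ge0$, from $\Gamma_i,x\colon P_i\vdash t\colon Q_i$ ($1\le i\le n$) infer $\biguplus_i\Gamma_i\vdash\lambda x.t\colon[P_1\multimap Q_1,\dots,P_n\multimap Q_n]$. Semantics: $[\![t]\!]_{\vec{x}} = \{((P_1,\dots,P_k),Q) \mid \text{there is a derivation of } x_1\colon P_1,\dots,x_k\colon P_k \vdash t \colon Q\}$. -}

module Defs where

open import Data.Nat using (ℕ; zero; suc)
open import Data.Fin using (Fin; zero; suc)
open import Data.List using (List; []; _∷_; _++_)
open import Data.Vec using (Vec; replicate; zipWith; _[_]≔_) renaming (_∷_ to _∷ᵥ_)
open import Data.Vec.Relation.Binary.Pointwise.Inductive using (Pointwise)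
open import Data.Product using (Σ; _×_; _,_)
open import Relation.Binary.Construct.Closure.ReflexiveTransitive using (Star)
open import Relation.Nullary using (¬_)

-- Term k = terms whose free variables are among k distinct variables
-- x₁ … x_k  (variable x_i is represented by an element of Fin k).

data Term (n : ℕ) : Set where
  var : Fin n → Term n
  ƛ_  : Term (suc n) → Term n
  _·_ : Term n → Term n → Term n

infixl 7 _·_

data Value {n : ℕ} : Term n → Set where
  var-val : (i : Fin n) → Value (var i)
  lam-val : (t : Term (suc n)) → Value (ƛ t)

ext : ∀ {m n} → (Fin m → Fin n) → Fin (suc m) → Fin (suc n)
ext ρ zero    = zero
ext ρ (suc i) = suc (ρ i)

rename : ∀ {m n} → (Fin m → Fin n) → Term m → Term n
rename ρ (var i) = var (ρ i)
rename ρ (ƛ t)   = ƛ rename (ext ρ) t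
rename ρ (t · u) = rename ρ t · rename ρ u

weaken : ∀ {n} → Term n → Term (suc n)
weaken = rename suc

exts : ∀ {m n} → (Fin m → Term n) → Fin (suc m) → Term (suc n)
exts σ zero    = var zero
exts σ (suc i) = weaken (σ i)

sub : ∀ {m n} → (Fin m → Term n) → Term m → Term n
sub σ (var i) = σ i
sub σ (ƛ t)   = ƛ sub (exts σ) t
sub σ (t · u) = sub σ t · sub σ u

-- t ⟪ v ⟫ = t{v/x} where x is the variable bound at index 0
_⟪_⟫ : ∀ {n} → Term (suc n) → Term n → Term n
t ⟪ v ⟫ = sub σ t
  where
  σ : Fin (suc _) → Term _
  σ zero    = v
  σ (suc i) = var i

-- The shuffling reduction  →sh̄ : root rules βv, σ1, σ3 closed under
-- balanced contexts  B ::= [·] | (λx.B)t | Bt | tB.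
-- Side conditions x ∉ fv(s), x ∉ fv(v) are expressed by weakening.

data _⟶_ {n : ℕ} : Term n → Term n → Set where
  βv    : ∀ {t : Term (suc n)} {v : Term n} → Value v →
          ((ƛ t) · v) ⟶ (t ⟪ v ⟫)
  σ₁    : ∀ {t : Term (suc n)} {u s : Term n} →
          ((ƛ t) · u · s) ⟶ ((ƛ (t · weaken s)) · u)
  σ₃    : ∀ {v u : Term n} {s : Term (suc n)} → Value v →
          (v · ((ƛ s) · u)) ⟶ ((ƛ (weaken v · s)) · u)
  ξ-λ   : ∀ {t t' : Term (suc n)} {u : Term n} →
          t ⟶ t' → ((ƛ t) · u) ⟶ ((ƛ t') · u)
  ξ-appL : ∀ {t t' u : Term n} → t ⟶ t' → (t · u) ⟶ (t' · u)
  ξ-appR : ∀ {t u u' : Term n} → u ⟶ u' → (t · u) ⟶ (t · u')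

infix 4 _⟶_ _⟶*_

_⟶*_ : ∀ {n} → Term n → Term n → Set
_⟶*_ = Star _⟶_

Normal : ∀ {n} → Term n → Set
Normal {n} t = ∀ (t' : Term n) → ¬ (t ⟶ t')

Normalizable : ∀ {n} → Term n → Set
Normalizable {n} t = Σ (Term n) λ t' → (t ⟶* t') × Normal t'

-- Types.  Positive types are finite multisets of negative types,
-- represented as lists considered up to (deep) permutation _≈P_.

data Neg : Set where
  _⊸_ : List Neg → List Neg → Neg

infixr 5 _⊸_

Pos : Set
Pos = List Neg

𝟎 : Pos
𝟎 = []

mutual
  data _≈N_ : Neg → Neg → Set where
    ⊸-cong : ∀ {P P' Q Q'} → P ≈P P' → Q ≈P Q' → (P ⊸ Q) ≈N (P' ⊸ Q')

  data _≈P_ : Pos → Pos → Set where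
    []≈    : [] ≈P []
    prep  : ∀ {N N' P P'} → N ≈N N' → P ≈P P' → (N ∷ P) ≈P (N' ∷ P')
    swap  : ∀ {N M P} → (N ∷ M ∷ P) ≈P (M ∷ N ∷ P)
    trans≈ : ∀ {P Q R} → P ≈P Q → Q ≈P R → P ≈P R

-- Environments for terms in scope n: the positive type of each x_i
-- (all other variables implicitly get 𝟎).
Env : ℕ → Set
Env n = Vec Pos n

𝟎ₑ : ∀ n → Env n
𝟎ₑ n = replicate n 𝟎

_⊎ₑ_ : ∀ {n} → Env n → Env n → Env n
_⊎ₑ_ = zipWith _++_

_≈E_ : ∀ {n} → Env n → Env n → Set
_≈E_ = Pointwise _≈P_

infix 3 _⊢_∶_

mutual
  data _⊢_∶_ {n : ℕ} : Env n → Term n → Pos → Set where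
    ax   : ∀ (i : Fin n) (P : Pos) → (𝟎ₑ n [ i ]≔ P) ⊢ var i ∶ P
    app  : ∀ {Γ Δ t u P Q} → Γ ⊢ t ∶ ((P ⊸ Q) ∷ []) → Δ ⊢ u ∶ P →
           (Γ ⊎ₑ Δ) ⊢ t · u ∶ Q
    lam  : ∀ {Γ t L} → LamPremises Γ t L → Γ ⊢ ƛ t ∶ L
    -- derivations are on multisets: judgments are identified up to ≈
    conv : ∀ {Γ Γ' t P P'} → Γ ⊢ t ∶ P → Γ ≈E Γ' → P ≈P P' → Γ' ⊢ t ∶ P'

  -- the n ≥ 0 premises Γᵢ , x : Pᵢ ⊢ t : Qᵢ of the (λ) rule,
  -- with total environment ⊎ᵢ Γᵢ and resulting type [P₁ ⊸ Q₁, …]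
  data LamPremises {n : ℕ} : Env n → Term (suc n) → List Neg → Set where
    none : ∀ {t} → LamPremises (𝟎ₑ n) t []
    more : ∀ {Γ Δ t P Q L} → (P ∷ᵥ Γ) ⊢ t ∶ Q → LamPremises Δ t L →
           LamPremises (Γ ⊎ₑ Δ) t ((P ⊸ Q) ∷ L)

⟦_⟧ : ∀ {k} → Term k → Vec Pos k × Pos → Set
⟦ t ⟧ (Γ , Q) = Γ ⊢ t ∶ Q

module Submission where

-- Typing is preserved by ⟶ and, since only values are substituted, also reflected by it.
-- So (1) ⇒ (3): the value normal form has type 𝟎 in the empty environment. For (3) ⇒ (1),
-- each step from a typed term decreases lexicographically the pair (number of (@) rules
-- of the derivation, μ t): substituting a value is additive on derivation sizes, so a βv
-- step erases exactly one (@) rule, while σ₁ and σ₃ keep the size and decrease the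
-- polynomial interpretation μ. Hence typable terms normalize. A normal application cannot
-- be typed in the empty environment: its head is a variable (whose type is non-empty), or
-- an abstraction whose normal argument would then be a value (a βv-redex), or again a
-- normal application. Finally (2) and (3) coincide by the definition of ⟦_⟧.

open import Defs
open import Level using (0ℓ)
open import Algebra.Bundles using (CommutativeMonoid)
open import Algebra.Structures using (IsCommutativeMonoid)
import Algebra.Properties.CommutativeSemigroup as CommutativeSemigroupProperties
import Algebra.Properties.CommutativeMonoid.Sum as CommutativeMonoidSum
open import Data.Empty using (⊥-elim)
open import Data.Fin using (Fin; zero; suc; punchIn)
open import Data.Fin.Properties using (_≟_; punchInᵢ≢i)
open import Data.List using ([]; _∷_; _++_; [_]; length)
open import Data.List.Properties using (++-assoc; ++-identityʳ; ++-conicalˡ; ++-conicalʳ)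
open import Data.Nat using (ℕ; zero; suc; _+_; _*_; _<_; s≤s; z≤n; NonZero; >-nonZero)
open import Data.Nat.Induction using (<-wellFounded)
open import Data.Nat.Properties
  using ( +-identityʳ; +-assoc; +-suc; *-comm; ≤-reflexive; ≤-trans; <⇒≤; m<n⇒m<1+n
        ; +-monoˡ-<; +-monoʳ-<; *-monoˡ-<; *-monoʳ-<; *-mono-≤; m<m*n
        ; +-commutativeSemigroup; +-0-commutativeMonoid; module ≤-Reasoning )
open import Data.Nat.Tactic.RingSolver using (solve-∀)
open import Data.Product using (Σ; ∃; _×_; _,_; proj₁; proj₂)
open import Data.Product.Relation.Binary.Lex.Strict using (×-Lex; ×-wellFounded)
open import Data.Sum using (_⊎_; inj₁; inj₂)
open import Data.Vec using (lookup; _[_]≔_; insertAt) renaming (_∷_ to _∷ᵥ_; [] to []ᵥ)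
open import Data.Vec.Properties using (lookup-replicate; lookup-zipWith; lookup∘update; lookup∘update′)
open import Data.Vec.Functional using (Vector; updateAt) renaming (_∷_ to _∷ᶠ_)
open import Data.Vec.Functional.Properties using (updateAt-updates; updateAt-minimal)
import Data.Vec.Relation.Binary.Pointwise.Inductive as Pointwise
open Pointwise using () renaming ([] to []ₚ; _∷_ to _∷ₚ_)
open import Function using (_∘_; _∘′_; id)
open import Function.Bundles using (_⇔_; mk⇔)
open import Induction.WellFounded using (WellFounded; Acc; acc)
open import Relation.Binary.Construct.Closure.ReflexiveTransitive as Star using (_◅_)
open import Relation.Binary.PropositionalEquality
  using (_≡_; _≢_; _≗_; refl; sym; trans; cong; cong₂; subst; subst₂; module ≡-Reasoning)
open import Relation.Nullary using (¬_; yes; no)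

module CommutativeMonoidSums {c ℓ} (M : CommutativeMonoid c ℓ) where
  open CommutativeMonoid M using (Carrier; _≈_; ε; ∙-congˡ; identityʳ) renaming (trans to ≈-trans)
  open CommutativeMonoidSum M using (sum; sum-cong-≋; sum-replicate-zero; sum-remove)

  sum-≈ε : ∀ {n} (t : Vector Carrier n) → (∀ i → t i ≈ ε) → sum t ≈ ε
  sum-≈ε {n} t t≈ε = ≈-trans (sum-cong-≋ t≈ε) (sum-replicate-zero n)

  sum-single : ∀ {n} (t : Vector Carrier n) j → (∀ i → i ≢ j → t i ≈ ε) → sum t ≈ t j
  sum-single {suc n} t j t≈ε =
    ≈-trans (sum-remove t) (≈-trans (∙-congˡ (sum-≈ε _ (λ i → t≈ε _ (punchInᵢ≢i j i)))) (identityʳ _))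

open CommutativeMonoidSums using (sum-≈ε; sum-single)

module +-CS = CommutativeSemigroupProperties +-commutativeSemigroup

-- Multisets and environments

mutual
  ≈N-refl : ∀ {N} → N ≈N N
  ≈N-refl {P ⊸ Q} = ⊸-cong ≈P-refl ≈P-refl

  ≈P-refl : ∀ {P} → P ≈P P
  ≈P-refl {[]}    = []≈
  ≈P-refl {N ∷ P} = prep ≈N-refl ≈P-refl

mutual
  ≈N-sym : ∀ {N M} → N ≈N M → M ≈N N
  ≈N-sym (⊸-cong p q) = ⊸-cong (≈P-sym p) (≈P-sym q)

  ≈P-sym : ∀ {P Q} → P ≈P Q → Q ≈P P
  ≈P-sym []≈          = []≈
  ≈P-sym (prep n p)   = prep (≈N-sym n) (≈P-sym p)
  ≈P-sym swap         = swap
  ≈P-sym (trans≈ p q) = trans≈ (≈P-sym q) (≈P-sym p)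

≈P-reflexive : ∀ {P Q} → P ≡ Q → P ≈P Q
≈P-reflexive refl = ≈P-refl

≈P-length : ∀ {P Q} → P ≈P Q → length P ≡ length Q
≈P-length []≈          = refl
≈P-length (prep _ p)   = cong suc (≈P-length p)
≈P-length swap         = refl
≈P-length (trans≈ p q) = trans (≈P-length p) (≈P-length q)

≈𝟎⇒≡𝟎 : ∀ {P} → P ≈P 𝟎 → P ≡ 𝟎
≈𝟎⇒≡𝟎 {[]}    _ = refl
≈𝟎⇒≡𝟎 {_ ∷ _} p with ≈P-length p
... | ()

++-congˡ : ∀ {P P'} Q → P ≈P P' → (P ++ Q) ≈P (P' ++ Q)
++-congˡ Q []≈          = ≈P-refl
++-congˡ Q (prep n p)   = prep n (++-congˡ Q p)
++-congˡ Q swap         = swap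
++-congˡ Q (trans≈ p q) = trans≈ (++-congˡ Q p) (++-congˡ Q q)

++-congʳ : ∀ P {Q Q'} → Q ≈P Q' → (P ++ Q) ≈P (P ++ Q')
++-congʳ []      q = q
++-congʳ (N ∷ P) q = prep ≈N-refl (++-congʳ P q)

++-cong : ∀ {P P' Q Q'} → P ≈P P' → Q ≈P Q' → (P ++ Q) ≈P (P' ++ Q')
++-cong {P' = P'} {Q = Q} p q = trans≈ (++-congˡ Q p) (++-congʳ P' q)

∷-middle : ∀ N P Q → (P ++ N ∷ Q) ≈P (N ∷ P ++ Q)
∷-middle N []      Q = ≈P-refl
∷-middle N (M ∷ P) Q = trans≈ (prep ≈N-refl (∷-middle N P Q)) swap

++-comm : ∀ P Q → (P ++ Q) ≈P (Q ++ P)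
++-comm []      Q = ≈P-reflexive (sym (++-identityʳ Q))
++-comm (N ∷ P) Q = trans≈ (prep ≈N-refl (++-comm P Q)) (≈P-sym (∷-middle N Q P))

Pos-isCommutativeMonoid : IsCommutativeMonoid _≈P_ _++_ 𝟎
Pos-isCommutativeMonoid = record
  { isMonoid = record
    { isSemigroup = record
      { isMagma = record
        { isEquivalence = record { refl = ≈P-refl ; sym = ≈P-sym ; trans = trans≈ }
        ; ∙-cong        = ++-cong
        }
      ; assoc = λ P Q R → ≈P-reflexive (++-assoc P Q R)
      }
    ; identity = (λ _ → ≈P-refl) , (λ P → ≈P-reflexive (++-identityʳ P))
    }
  ; comm = ++-comm
  }

Env-commutativeMonoid : ℕ → CommutativeMonoid 0ℓ 0ℓ
Env-commutativeMonoid n = record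
  { Carrier = Env n
  ; _≈_ = _≈E_
  ; _∙_ = _⊎ₑ_
  ; ε   = 𝟎ₑ n
  ; isCommutativeMonoid = record
    { isMonoid = record
      { isSemigroup = record
        { isMagma = record
          { isEquivalence = Pointwise.isEquivalence P.isEquivalence n
          ; ∙-cong        = Pointwise.zipWith-cong P.∙-cong
          }
        ; assoc = Pointwise.zipWith-assoc P.assoc
        }
      ; identity = Pointwise.zipWith-identityˡ P.identityˡ , Pointwise.zipWith-identityʳ P.identityʳ
      }
    ; comm = Pointwise.zipWith-comm P.comm
    }
  }
  where module P = IsCommutativeMonoid Pos-isCommutativeMonoid

module ≈E {n : ℕ} where
  open CommutativeMonoid (Env-commutativeMonoid n) public
    using (refl; sym; trans; reflexive; assoc; comm; identityˡ; identityʳ; ∙-cong; ∙-congˡ; ∙-congʳ)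
  open CommutativeSemigroupProperties (CommutativeMonoid.commutativeSemigroup (Env-commutativeMonoid n)) public
    using (x∙yz≈y∙xz; xy∙z≈xz∙y)

𝟎ₑ-⊎ₑ-𝟎ₑ : ∀ n → 𝟎ₑ n ≡ (𝟎ₑ n ⊎ₑ 𝟎ₑ n)
𝟎ₑ-⊎ₑ-𝟎ₑ zero    = refl
𝟎ₑ-⊎ₑ-𝟎ₑ (suc n) = cong (𝟎 ∷ᵥ_) (𝟎ₑ-⊎ₑ-𝟎ₑ n)

lookup-⊎ₑ : ∀ {n} (Γ Δ : Env n) i → lookup (Γ ⊎ₑ Δ) i ≡ lookup Γ i ++ lookup Δ i
lookup-⊎ₑ Γ Δ i = lookup-zipWith _++_ i Γ Δ

lookup-𝟎ₑ : ∀ {n} (i : Fin n) → lookup (𝟎ₑ n) i ≡ 𝟎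
lookup-𝟎ₑ i = lookup-replicate i 𝟎

⊎ₑ-conical : ∀ {n} {Γ Δ : Env n} → (Γ ⊎ₑ Δ) ≈E 𝟎ₑ n → Γ ≈E 𝟎ₑ n × Δ ≈E 𝟎ₑ n
⊎ₑ-conical {Γ = []ᵥ}    {[]ᵥ}    []ₚ        = []ₚ , []ₚ
⊎ₑ-conical {Γ = P ∷ᵥ Γ} {Q ∷ᵥ Δ} (p ∷ₚ ps) =
  ≈P-reflexive (++-conicalˡ P Q (≈𝟎⇒≡𝟎 p)) ∷ₚ proj₁ (⊎ₑ-conical ps) ,
  ≈P-reflexive (++-conicalʳ P Q (≈𝟎⇒≡𝟎 p)) ∷ₚ proj₂ (⊎ₑ-conical ps)

infix 4 _↦_

_↦_ : ∀ {n} → Fin n → Pos → Env n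
i ↦ P = 𝟎ₑ _ [ i ]≔ P

↦-𝟎 : ∀ {n} (i : Fin n) → (i ↦ 𝟎) ≡ 𝟎ₑ n
↦-𝟎 zero    = refl
↦-𝟎 (suc i) = cong (𝟎 ∷ᵥ_) (↦-𝟎 i)

↦-++ : ∀ {n} (i : Fin n) P Q → (i ↦ P ++ Q) ≡ ((i ↦ P) ⊎ₑ (i ↦ Q))
↦-++ {suc n} zero P Q = cong ((P ++ Q) ∷ᵥ_) (𝟎ₑ-⊎ₑ-𝟎ₑ n)
↦-++ (suc i) P Q      = cong (𝟎 ∷ᵥ_) (↦-++ i P Q)

↦-cong : ∀ {n} (i : Fin n) {P P'} → P ≈P P' → (i ↦ P) ≈E (i ↦ P')
↦-cong zero    p = p ∷ₚ ≈E.refl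
↦-cong (suc i) p = ≈P-refl ∷ₚ ↦-cong i p

↦-≉𝟎ₑ : ∀ {n} (i : Fin n) {N P} → ¬ ((i ↦ N ∷ P) ≈E 𝟎ₑ n)
↦-≉𝟎ₑ zero    (p ∷ₚ _) with ≈𝟎⇒≡𝟎 p
... | ()
↦-≉𝟎ₑ (suc i) (_ ∷ₚ h) = ↦-≉𝟎ₑ i h

lookup-↦ : ∀ {n} (i : Fin n) P → lookup (i ↦ P) i ≡ P
lookup-↦ i P = lookup∘update i (𝟎ₑ _) P

lookup-↦-≢ : ∀ {n} {i j : Fin n} P → i ≢ j → lookup (j ↦ P) i ≡ 𝟎
lookup-↦-≢ {i = i} P i≢j = trans (lookup∘update′ i≢j (𝟎ₑ _) P) (lookup-𝟎ₑ i)

-- Derivations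

convₑ : ∀ {n} {Γ Γ' : Env n} {t P} → Γ ⊢ t ∶ P → Γ ≈E Γ' → Γ' ⊢ t ∶ P
convₑ d Γ≈Γ' = conv d Γ≈Γ' ≈P-refl

-- Only (@) rules are counted, which makes substitution of values additive on sizes.
mutual
  size : ∀ {n} {Γ : Env n} {t P} → Γ ⊢ t ∶ P → ℕ
  size (ax _ _)     = 0
  size (app d e)    = suc (size d + size e)
  size (lam ps)     = sizeₚ ps
  size (conv d _ _) = size d

  sizeₚ : ∀ {n} {Γ : Env n} {t L} → LamPremises Γ t L → ℕ
  sizeₚ none        = 0
  sizeₚ (more d ps) = size d + sizeₚ ps

infix 3 _⊢_∶_⟨_⟩

_⊢_∶_⟨_⟩ : ∀ {n} → Env n → Term n → Pos → ℕ → Set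
Γ ⊢ t ∶ P ⟨ m ⟩ = Σ (Γ ⊢ t ∶ P) λ d → size d ≡ m

record Premises {n} (Γ : Env n) (t : Term (suc n)) (L : Pos) (m : ℕ) : Set where
  constructor premises
  field
    Γ₀     : Env n
    derivs : LamPremises Γ₀ t L
    env≈   : Γ ≈E Γ₀
    size≡  : m ≡ sizeₚ derivs

premises-perm : ∀ {n} {Γ : Env n} {t L L'} (ps : LamPremises Γ t L) → L ≈P L' →
                Premises Γ t L' (sizeₚ ps)
premises-perm none []≈ = premises _ none ≈E.refl refl
premises-perm (more d ps) (prep (⊸-cong P≈ Q≈) L≈) with premises-perm ps L≈
... | premises _ ps' Γ≈ size≡ =
  premises _ (more (conv d (P≈ ∷ₚ ≈E.refl) Q≈) ps') (≈E.∙-congˡ Γ≈) (cong (size d +_) size≡)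
premises-perm (more {Γ = Γ₁} d₁ (more {Γ = Γ₂} {Δ = Δ} d₂ ps)) swap =
  premises _ (more d₂ (more d₁ ps)) (≈E.x∙yz≈y∙xz Γ₁ Γ₂ Δ) (+-CS.x∙yz≈y∙xz (size d₁) (size d₂) (sizeₚ ps))
premises-perm ps (trans≈ L≈ L≈') with premises-perm ps L≈
... | premises _ ps' Γ≈ size≡ with premises-perm ps' L≈'
... | premises _ ps'' Γ≈' size≡' = premises _ ps'' (≈E.trans Γ≈ Γ≈') (trans size≡ size≡')

record SplitPremises {n} (Γ : Env n) (t : Term (suc n)) (L₁ L₂ : Pos) (m : ℕ) : Set where
  constructor split-premises
  field
    Γ₁ Γ₂   : Env n
    derivs₁ : LamPremises Γ₁ t L₁
    derivs₂ : LamPremises Γ₂ t L₂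
    env≈    : Γ ≈E (Γ₁ ⊎ₑ Γ₂)
    size≡   : m ≡ sizeₚ derivs₁ + sizeₚ derivs₂

premises-split : ∀ {n} {Γ : Env n} {t} L₁ {L₂} (ps : LamPremises Γ t (L₁ ++ L₂)) →
                 SplitPremises Γ t L₁ L₂ (sizeₚ ps)
premises-split []       ps = split-premises _ _ none ps (≈E.sym (≈E.identityˡ _)) refl
premises-split (_ ∷ L₁) (more {Γ = Γd} d ps) with premises-split L₁ ps
... | split-premises Γ₁ Γ₂ ps₁ ps₂ Γ≈ size≡ =
  split-premises _ _ (more d ps₁) ps₂
    (≈E.trans (≈E.∙-congˡ Γ≈) (≈E.sym (≈E.assoc Γd Γ₁ Γ₂)))
    (trans (cong (size d +_) size≡) (sym (+-assoc (size d) (sizeₚ ps₁) (sizeₚ ps₂))))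

premises-++ : ∀ {n} {Γ₁ Γ₂ : Env n} {t L₁ L₂} (ps₁ : LamPremises Γ₁ t L₁) (ps₂ : LamPremises Γ₂ t L₂) →
              Premises (Γ₁ ⊎ₑ Γ₂) t (L₁ ++ L₂) (sizeₚ ps₁ + sizeₚ ps₂)
premises-++ none ps₂ = premises _ ps₂ (≈E.identityˡ _) refl
premises-++ (more {Γ = Γd} {Δ = Δ} d ps₁) ps₂ with premises-++ ps₁ ps₂
... | premises _ ps Γ≈ size≡ =
  premises _ (more d ps) (≈E.trans (≈E.assoc Γd Δ _) (≈E.∙-congˡ Γ≈))
    (trans (+-assoc (size d) (sizeₚ ps₁) (sizeₚ ps₂)) (cong (size d +_) size≡))

invert-var : ∀ {n} {Γ : Env n} {i P} (d : Γ ⊢ var i ∶ P) → Γ ≈E (i ↦ P) × size d ≡ 0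
invert-var (ax i P)     = ≈E.refl , refl
invert-var (conv d Γ≈ P≈) with invert-var d
... | Γ≈↦ , size≡ = ≈E.trans (≈E.sym Γ≈) (≈E.trans Γ≈↦ (↦-cong _ P≈)) , size≡

record AppInversion {n} (Γ : Env n) (t u : Term n) (Q : Pos) (m : ℕ) : Set where
  constructor app-inversion
  field
    Γ₁ Γ₂ : Env n
    A     : Pos
    fun   : Γ₁ ⊢ t ∶ [ A ⊸ Q ]
    arg   : Γ₂ ⊢ u ∶ A
    env≈  : Γ ≈E (Γ₁ ⊎ₑ Γ₂)
    size≡ : m ≡ suc (size fun + size arg)

invert-app : ∀ {n} {Γ : Env n} {t u Q} (d : Γ ⊢ t · u ∶ Q) → AppInversion Γ t u Q (size d)
invert-app (app d e) = app-inversion _ _ _ d e ≈E.refl refl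
invert-app (conv d Γ≈ Q≈) with invert-app d
... | app-inversion Γ₁ Γ₂ A d₁ d₂ Γ≈⊎ size≡ =
  app-inversion Γ₁ Γ₂ A (conv d₁ ≈E.refl (prep (⊸-cong ≈P-refl Q≈) []≈)) d₂ (≈E.trans (≈E.sym Γ≈) Γ≈⊎) size≡

invert-lam : ∀ {n} {Γ : Env n} {t L} (d : Γ ⊢ ƛ t ∶ L) → Premises Γ t L (size d)
invert-lam (lam ps) = premises _ ps ≈E.refl refl
invert-lam (conv d Γ≈ L≈) with invert-lam d
... | premises _ ps Γ≈₀ size≡ with premises-perm ps L≈
... | premises Γ₀' ps' Γ≈₀' size≡' =
  premises Γ₀' ps' (≈E.trans (≈E.sym Γ≈) (≈E.trans Γ≈₀ Γ≈₀')) (trans size≡ size≡')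

invert-lam₁ : ∀ {n} {Γ : Env n} {t A B} (d : Γ ⊢ ƛ t ∶ [ A ⊸ B ]) → (A ∷ᵥ Γ) ⊢ t ∶ B ⟨ size d ⟩
invert-lam₁ d with invert-lam d
... | premises _ (more {Γ = Γ'} d' none) Γ≈ size≡ =
  convₑ d' (≈P-refl ∷ₚ ≈E.sym (≈E.trans Γ≈ (≈E.identityʳ Γ'))) , sym (trans size≡ (+-identityʳ (size d')))

lam₁ : ∀ {n} {Γ : Env n} {t A B} (d : (A ∷ᵥ Γ) ⊢ t ∶ B) → Γ ⊢ ƛ t ∶ [ A ⊸ B ] ⟨ size d ⟩
lam₁ {Γ = Γ} d = convₑ (lam (more d none)) (≈E.identityʳ Γ) , +-identityʳ (size d)

record RedexInversion {n} (Γ : Env n) (t : Term (suc n)) (u : Term n) (Q : Pos) (m : ℕ) : Set where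
  constructor redex-inversion
  field
    Γ₁ Γ₂ : Env n
    A     : Pos
    body  : (A ∷ᵥ Γ₁) ⊢ t ∶ Q
    arg   : Γ₂ ⊢ u ∶ A
    env≈  : Γ ≈E (Γ₁ ⊎ₑ Γ₂)
    size≡ : m ≡ suc (size body + size arg)

invert-redex : ∀ {n} {Γ : Env n} {t u Q} (d : Γ ⊢ (ƛ t) · u ∶ Q) → RedexInversion Γ t u Q (size d)
invert-redex d with invert-app d
... | app-inversion Γ₁ Γ₂ A dλ du Γ≈ size≡ with invert-lam₁ dλ
... | body , body-size =
  redex-inversion Γ₁ Γ₂ A body du Γ≈ (trans size≡ (cong (λ k → suc (k + size du)) (sym body-size)))

redex : ∀ {n} {Γ₁ Γ₂ : Env n} {t u A Q} (body : (A ∷ᵥ Γ₁) ⊢ t ∶ Q) (arg : Γ₂ ⊢ u ∶ A) →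
        (Γ₁ ⊎ₑ Γ₂) ⊢ (ƛ t) · u ∶ Q ⟨ suc (size body + size arg) ⟩
redex body arg with lam₁ body
... | dλ , size≡ = app dλ arg , cong (λ k → suc (k + size arg)) size≡

value-⊢𝟎 : ∀ {n} {v : Term n} → Value v → 𝟎ₑ n ⊢ v ∶ 𝟎
value-⊢𝟎 (var-val i) = convₑ (ax i 𝟎) (≈E.reflexive (↦-𝟎 i))
value-⊢𝟎 (lam-val t) = lam none

invert-value-𝟎 : ∀ {n} {Γ : Env n} {v} → Value v → (d : Γ ⊢ v ∶ 𝟎) → Γ ≈E 𝟎ₑ n × size d ≡ 0
invert-value-𝟎 (var-val i) d with invert-var d
... | Γ≈ , size≡ = ≈E.trans Γ≈ (≈E.reflexive (↦-𝟎 i)) , size≡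
invert-value-𝟎 (lam-val t) d with invert-lam d
... | premises _ none Γ≈ size≡ = Γ≈ , size≡

-- Typings of a value split and merge along its type; this is what allows a value to be
-- substituted for several occurrences of a variable.
record ValueSplit {n} (Γ : Env n) (v : Term n) (P₁ P₂ : Pos) (m : ℕ) : Set where
  constructor value-split
  field
    Γ₁ Γ₂ : Env n
    left  : Γ₁ ⊢ v ∶ P₁
    right : Γ₂ ⊢ v ∶ P₂
    env≈  : Γ ≈E (Γ₁ ⊎ₑ Γ₂)
    size≡ : m ≡ size left + size right

split-value : ∀ {n} {Γ : Env n} {v} P₁ P₂ → Value v → (d : Γ ⊢ v ∶ P₁ ++ P₂) →
              ValueSplit Γ v P₁ P₂ (size d)
split-value P₁ P₂ (var-val i) d with invert-var d
... | Γ≈ , size≡ = value-split _ _ (ax i P₁) (ax i P₂) (≈E.trans Γ≈ (≈E.reflexive (↦-++ i P₁ P₂))) size≡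
split-value P₁ P₂ (lam-val t) d with invert-lam d
... | premises _ ps Γ≈ size≡ with premises-split P₁ ps
... | split-premises Γ₁ Γ₂ ps₁ ps₂ Γ≈⊎ size≡⊎ =
  value-split Γ₁ Γ₂ (lam ps₁) (lam ps₂) (≈E.trans Γ≈ Γ≈⊎) (trans size≡ size≡⊎)

merge-value : ∀ {n} {Γ₁ Γ₂ : Env n} {v P₁ P₂} → Value v → Γ₁ ⊢ v ∶ P₁ → Γ₂ ⊢ v ∶ P₂ →
              (Γ₁ ⊎ₑ Γ₂) ⊢ v ∶ P₁ ++ P₂
merge-value {P₁ = P₁} {P₂} (var-val i) d₁ d₂ =
  convₑ (ax i (P₁ ++ P₂))
    (≈E.trans (≈E.reflexive (↦-++ i P₁ P₂))
              (≈E.∙-cong (≈E.sym (proj₁ (invert-var d₁))) (≈E.sym (proj₁ (invert-var d₂)))))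
merge-value (lam-val t) d₁ d₂ with invert-lam d₁ | invert-lam d₂
... | premises _ ps₁ Γ≈₁ _ | premises _ ps₂ Γ≈₂ _ with premises-++ ps₁ ps₂
... | premises _ ps Γ≈ _ = convₑ (lam ps) (≈E.sym (≈E.trans (≈E.∙-cong Γ≈₁ Γ≈₂) Γ≈))

-- Weakening and strengthening

insert𝟎 : ∀ {n} → Fin (suc n) → Env n → Env (suc n)
insert𝟎 p Γ = insertAt Γ p 𝟎

insert𝟎-𝟎ₑ : ∀ {n} (p : Fin (suc n)) → insert𝟎 p (𝟎ₑ n) ≡ 𝟎ₑ (suc n)
insert𝟎-𝟎ₑ zero            = refl
insert𝟎-𝟎ₑ {suc n} (suc p) = cong (𝟎 ∷ᵥ_) (insert𝟎-𝟎ₑ p)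

insert𝟎-⊎ₑ : ∀ {n} p (Γ Δ : Env n) → insert𝟎 p (Γ ⊎ₑ Δ) ≡ (insert𝟎 p Γ ⊎ₑ insert𝟎 p Δ)
insert𝟎-⊎ₑ zero    Γ          Δ          = refl
insert𝟎-⊎ₑ (suc p) (P ∷ᵥ Γ) (Q ∷ᵥ Δ) = cong ((P ++ Q) ∷ᵥ_) (insert𝟎-⊎ₑ p Γ Δ)

insert𝟎-↦ : ∀ {n} p (j : Fin n) P → insert𝟎 p (j ↦ P) ≡ (punchIn p j ↦ P)
insert𝟎-↦ zero            j       P = refl
insert𝟎-↦ {suc n} (suc p) zero    P = cong (P ∷ᵥ_) (insert𝟎-𝟎ₑ p)
insert𝟎-↦ {suc n} (suc p) (suc j) P = cong (𝟎 ∷ᵥ_) (insert𝟎-↦ p j P)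

insert𝟎-cong : ∀ {n} {Γ Δ : Env n} p → Γ ≈E Δ → insert𝟎 p Γ ≈E insert𝟎 p Δ
insert𝟎-cong zero    Γ≈Δ        = ≈P-refl ∷ₚ Γ≈Δ
insert𝟎-cong (suc p) (P≈ ∷ₚ Γ≈Δ) = P≈ ∷ₚ insert𝟎-cong p Γ≈Δ

ext-punchIn : ∀ {m} {p : Fin (suc m)} {ρ : Fin m → Fin (suc m)} → ρ ≗ punchIn p → ext ρ ≗ punchIn (suc p)
ext-punchIn ρ≗ zero    = refl
ext-punchIn ρ≗ (suc i) = cong suc (ρ≗ i)

mutual
  weaken-⊢ : ∀ {m} {Γ : Env m} {t Q} p {ρ} → ρ ≗ punchIn p → (d : Γ ⊢ t ∶ Q) →
             insert𝟎 p Γ ⊢ rename ρ t ∶ Q ⟨ size d ⟩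
  weaken-⊢ p {ρ} ρ≗ (ax j P) =
    convₑ (ax (ρ j) P) (≈E.reflexive (sym (trans (insert𝟎-↦ p j P) (cong (_↦ P) (sym (ρ≗ j)))))) , refl
  weaken-⊢ p ρ≗ (app {Γ = Γ} {Δ = Δ} d e) with weaken-⊢ p ρ≗ d | weaken-⊢ p ρ≗ e
  ... | d' , d≡ | e' , e≡ =
    convₑ (app d' e') (≈E.reflexive (sym (insert𝟎-⊎ₑ p Γ Δ))) , cong₂ (λ a b → suc (a + b)) d≡ e≡
  weaken-⊢ p ρ≗ (lam ps) with weakenₚ p ρ≗ ps
  ... | premises _ ps' Γ≈ size≡ = convₑ (lam ps') (≈E.sym Γ≈) , sym size≡
  weaken-⊢ p ρ≗ (conv d Γ≈ Q≈) with weaken-⊢ p ρ≗ d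
  ... | d' , size≡ = conv d' (insert𝟎-cong p Γ≈) Q≈ , size≡

  weakenₚ : ∀ {m} {Γ : Env m} {t L} p {ρ} → ρ ≗ punchIn p → (ps : LamPremises Γ t L) →
            Premises (insert𝟎 p Γ) (rename (ext ρ) t) L (sizeₚ ps)
  weakenₚ p ρ≗ none = premises _ none (≈E.reflexive (insert𝟎-𝟎ₑ p)) refl
  weakenₚ p ρ≗ (more {Γ = Γ₁} {Δ = Δ} d ps) with weaken-⊢ (suc p) (ext-punchIn ρ≗) d | weakenₚ p ρ≗ ps
  ... | d' , d≡ | premises _ ps' Γ≈ size≡ =
    premises _ (more d' ps') (≈E.trans (≈E.reflexive (insert𝟎-⊎ₑ p Γ₁ Δ)) (≈E.∙-congˡ Γ≈))
      (cong₂ _+_ (sym d≡) size≡)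

weaken-⊢₀ : ∀ {m} {Γ : Env m} {t Q} (d : Γ ⊢ t ∶ Q) → (𝟎 ∷ᵥ Γ) ⊢ weaken t ∶ Q ⟨ size d ⟩
weaken-⊢₀ = weaken-⊢ zero (λ _ → refl)

mutual
  strengthen-⊢ : ∀ {m} (t : Term m) {Γ : Env (suc m)} {Q} p {ρ} → ρ ≗ punchIn p →
                 Γ ⊢ rename ρ t ∶ Q → ∃ λ Γ' → Γ' ⊢ t ∶ Q × Γ ≈E insert𝟎 p Γ'
  strengthen-⊢ (var j) {Q = Q} p ρ≗ d =
    _ , ax j Q ,
    ≈E.trans (proj₁ (invert-var d)) (≈E.reflexive (trans (cong (_↦ Q) (ρ≗ j)) (sym (insert𝟎-↦ p j Q))))
  strengthen-⊢ (t · u) p ρ≗ d with invert-app d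
  ... | app-inversion _ _ _ d₁ d₂ Γ≈ _ with strengthen-⊢ t p ρ≗ d₁ | strengthen-⊢ u p ρ≗ d₂
  ... | Γ₁ , d₁' , Γ≈₁ | Γ₂ , d₂' , Γ≈₂ =
    _ , app d₁' d₂' , ≈E.trans Γ≈ (≈E.trans (≈E.∙-cong Γ≈₁ Γ≈₂) (≈E.reflexive (sym (insert𝟎-⊎ₑ p Γ₁ Γ₂))))
  strengthen-⊢ (ƛ t) p ρ≗ d with invert-lam d
  ... | premises _ ps Γ≈ _ with strengthenₚ t p ρ≗ ps
  ... | Γ' , ps' , Γ≈' = Γ' , lam ps' , ≈E.trans Γ≈ Γ≈'

  strengthenₚ : ∀ {m} (t : Term (suc m)) {Γ : Env (suc m)} {L} p {ρ} → ρ ≗ punchIn p →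
                LamPremises Γ (rename (ext ρ) t) L → ∃ λ Γ' → LamPremises Γ' t L × Γ ≈E insert𝟎 p Γ'
  strengthenₚ t p ρ≗ none = _ , none , ≈E.reflexive (sym (insert𝟎-𝟎ₑ p))
  strengthenₚ t p ρ≗ (more d ps) with strengthen-⊢ t (suc p) (ext-punchIn ρ≗) d | strengthenₚ t p ρ≗ ps
  ... | (_ ∷ᵥ Γ₁) , d' , (P≈ ∷ₚ Γ≈₁) | Γ₂ , ps' , Γ≈₂ =
    _ , more (conv d' (≈P-sym P≈ ∷ₚ ≈E.refl) ≈P-refl) ps' ,
    ≈E.trans (≈E.∙-cong Γ≈₁ Γ≈₂) (≈E.reflexive (sym (insert𝟎-⊎ₑ p Γ₁ Γ₂)))

strengthen-⊢₀ : ∀ {m} (t : Term m) {Γ : Env (suc m)} {Q} → Γ ⊢ weaken t ∶ Q →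
                ∃ λ Γ' → Γ' ⊢ t ∶ Q × Γ ≈E (𝟎 ∷ᵥ Γ')
strengthen-⊢₀ t = strengthen-⊢ t zero (λ _ → refl)

-- Substitution of values

module EnvSum {n : ℕ} = CommutativeMonoidSum (Env-commutativeMonoid n)
module ℕSum = CommutativeMonoidSum +-0-commutativeMonoid

∑ₑ : ∀ {m n} → (Fin m → Env n) → Env n
∑ₑ = EnvSum.sum

∑ : ∀ {m} → (Fin m → ℕ) → ℕ
∑ = ℕSum.sum

+-interchange-parts : ∀ a b {s₁ s₂ x y s} → x ≡ a + s₁ → y ≡ b + s₂ → s ≡ s₁ + s₂ → x + y ≡ (a + b) + s
+-interchange-parts a b {s₁} {s₂} refl refl refl = +-CS.interchange a s₁ b s₂

AllValue : ∀ {m n} → (Fin m → Term n) → Set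
AllValue σ = ∀ i → Value (σ i)

rename-value : ∀ {m n} (ρ : Fin m → Fin n) {v} → Value v → Value (rename ρ v)
rename-value ρ (var-val i) = var-val (ρ i)
rename-value ρ (lam-val t) = lam-val _

exts-value : ∀ {m n} {σ : Fin m → Term n} → AllValue σ → AllValue (exts σ)
exts-value σ-val zero    = var-val zero
exts-value σ-val (suc i) = rename-value suc (σ-val i)

infix 3 _⊢ˢ_∶_

record _⊢ˢ_∶_ {m n} (D : Fin m → Env n) (σ : Fin m → Term n) (Γ : Env m) : Set where
  constructor typings
  field at : ∀ i → D i ⊢ σ i ∶ lookup Γ i
open _⊢ˢ_∶_

sizeˢ : ∀ {m n} {D : Fin m → Env n} {σ Γ} → D ⊢ˢ σ ∶ Γ → ℕ
sizeˢ ds = ∑ (λ i → size (at ds i))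

record SplitTypings {m n} (D : Fin m → Env n) (σ : Fin m → Term n) (Γ₁ Γ₂ : Env m) (k : ℕ) : Set where
  constructor split-typings
  field
    D₁ D₂    : Fin m → Env n
    typings₁ : D₁ ⊢ˢ σ ∶ Γ₁
    typings₂ : D₂ ⊢ˢ σ ∶ Γ₂
    env≈     : ∑ₑ D ≈E (∑ₑ D₁ ⊎ₑ ∑ₑ D₂)
    size≡    : k ≡ sizeˢ typings₁ + sizeˢ typings₂

split-⊢ˢ : ∀ {m n} {D : Fin m → Env n} {σ Γ₁ Γ₂} → AllValue σ → (ds : D ⊢ˢ σ ∶ (Γ₁ ⊎ₑ Γ₂)) →
           SplitTypings D σ Γ₁ Γ₂ (sizeˢ ds)
split-⊢ˢ {D = D} {Γ₁ = Γ₁} {Γ₂} σ-val ds =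
  split-typings D₁ D₂ (typings (λ i → ValueSplit.left (part i))) (typings (λ i → ValueSplit.right (part i)))
    (≈E.trans (EnvSum.sum-cong-≋ {x = D} (λ i → ValueSplit.env≈ (part i))) (EnvSum.∑-distrib-+ D₁ D₂))
    (trans (ℕSum.sum-cong-≗ (λ i → ValueSplit.size≡ (part i)))
           (ℕSum.∑-distrib-+ (λ i → size (ValueSplit.left (part i))) (λ i → size (ValueSplit.right (part i)))))
  where
  part : ∀ i → ValueSplit (D i) _ (lookup Γ₁ i) (lookup Γ₂ i) (size (at ds i))
  part i = split-value _ _ (σ-val i) (conv (at ds i) ≈E.refl (≈P-reflexive (lookup-⊎ₑ Γ₁ Γ₂ i)))
  D₁ D₂ : Fin _ → Env _
  D₁ i = ValueSplit.Γ₁ (part i)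
  D₂ i = ValueSplit.Γ₂ (part i)

merge-⊢ˢ : ∀ {m n} {D₁ D₂ : Fin m → Env n} {σ Γ₁ Γ₂} → AllValue σ →
           D₁ ⊢ˢ σ ∶ Γ₁ → D₂ ⊢ˢ σ ∶ Γ₂ → (λ i → D₁ i ⊎ₑ D₂ i) ⊢ˢ σ ∶ (Γ₁ ⊎ₑ Γ₂)
merge-⊢ˢ {Γ₁ = Γ₁} {Γ₂} σ-val ds₁ ds₂ = typings λ i →
  conv (merge-value (σ-val i) (at ds₁ i) (at ds₂ i)) ≈E.refl (≈P-reflexive (sym (lookup-⊎ₑ Γ₁ Γ₂ i)))

∑ₑ-𝟎∷ : ∀ {m n} (D : Fin m → Env n) → ∑ₑ (λ i → 𝟎 ∷ᵥ D i) ≡ (𝟎 ∷ᵥ ∑ₑ D)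
∑ₑ-𝟎∷ {zero}  D = refl
∑ₑ-𝟎∷ {suc m} D = cong ((𝟎 ∷ᵥ D zero) ⊎ₑ_) (∑ₑ-𝟎∷ (λ i → D (suc i)))

extsₑ : ∀ {m n} → Pos → (Fin m → Env n) → Fin (suc m) → Env (suc n)
extsₑ P D zero    = zero ↦ P
extsₑ P D (suc i) = 𝟎 ∷ᵥ D i

∑ₑ-extsₑ : ∀ {m n} P (D : Fin m → Env n) → ∑ₑ (extsₑ P D) ≈E (P ∷ᵥ ∑ₑ D)
∑ₑ-extsₑ P D =
  ≈E.trans (≈E.∙-congˡ (≈E.reflexive (∑ₑ-𝟎∷ D))) (≈P-reflexive (++-identityʳ P) ∷ₚ ≈E.identityˡ (∑ₑ D))

exts-⊢ˢ : ∀ {m n} {D : Fin m → Env n} {σ Γ} P → D ⊢ˢ σ ∶ Γ → extsₑ P D ⊢ˢ exts σ ∶ (P ∷ᵥ Γ)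
exts-⊢ˢ P ds = typings λ { zero → ax zero P ; (suc i) → proj₁ (weaken-⊢₀ (at ds i)) }

sizeˢ-exts : ∀ {m n} {D : Fin m → Env n} {σ Γ} P (ds : D ⊢ˢ σ ∶ Γ) → sizeˢ (exts-⊢ˢ P ds) ≡ sizeˢ ds
sizeˢ-exts P ds = ℕSum.sum-cong-≗ (λ i → proj₂ (weaken-⊢₀ (at ds i)))

exts-⊢ˢ⁻¹ : ∀ {m n} {D : Fin (suc m) → Env (suc n)} {σ : Fin m → Term n} {P Γ} →
            D ⊢ˢ exts σ ∶ (P ∷ᵥ Γ) → ∃ λ E → E ⊢ˢ σ ∶ Γ × ∑ₑ D ≈E (P ∷ᵥ ∑ₑ E)
exts-⊢ˢ⁻¹ {D = D} {σ} {P} {Γ} ds =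
  E , typings (λ i → proj₁ (proj₂ (strengthened i))) ,
  ≈E.trans (EnvSum.sum-cong-≋ {x = D} {extsₑ P E} λ { zero → proj₁ (invert-var (at ds zero))
                                                     ; (suc i) → proj₂ (proj₂ (strengthened i)) })
           (∑ₑ-extsₑ P E)
  where
  strengthened : ∀ i → ∃ λ E' → E' ⊢ σ i ∶ lookup Γ i × D (suc i) ≈E (𝟎 ∷ᵥ E')
  strengthened i = strengthen-⊢₀ (σ i) (at ds (suc i))
  E : Fin _ → Env _
  E i = proj₁ (strengthened i)

mutual
  substitution : ∀ {m n} {Γ : Env m} {t Q} {σ : Fin m → Term n} {D} → AllValue σ →
                 (d : Γ ⊢ t ∶ Q) (ds : D ⊢ˢ σ ∶ Γ) → ∑ₑ D ⊢ sub σ t ∶ Q ⟨ size d + sizeˢ ds ⟩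
  substitution {D = D} σ-val (ax j P) ds =
    conv (at ds j) (≈E.sym (sum-single (Env-commutativeMonoid _) D j (λ i i≢j → proj₁ (vanishes i i≢j))))
      (≈P-reflexive (lookup-↦ j P)) ,
    sym (sum-single +-0-commutativeMonoid _ j (λ i i≢j → proj₂ (vanishes i i≢j)))
    where
    vanishes : ∀ i → i ≢ j → D i ≈E 𝟎ₑ _ × size (at ds i) ≡ 0
    vanishes i i≢j = invert-value-𝟎 (σ-val i) (conv (at ds i) ≈E.refl (≈P-reflexive (lookup-↦-≢ P i≢j)))
  substitution σ-val (app d e) ds with split-⊢ˢ σ-val ds
  ... | split-typings _ _ ds₁ ds₂ D≈ size≡ with substitution σ-val d ds₁ | substitution σ-val e ds₂
  ... | d' , d≡ | e' , e≡ =
    convₑ (app d' e') (≈E.sym D≈) , cong suc (+-interchange-parts (size d) (size e) d≡ e≡ size≡)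
  substitution σ-val (lam ps) ds with substitutionₚ σ-val ps ds
  ... | premises _ ps' Γ≈ size≡ = convₑ (lam ps') (≈E.sym Γ≈) , sym size≡
  substitution σ-val (conv d Γ≈ Q≈) ds
    with substitution σ-val d (typings λ i → conv (at ds i) ≈E.refl (≈P-sym (Pointwise.lookup Γ≈ i)))
  ... | d' , size≡ = conv d' ≈E.refl Q≈ , size≡

  substitutionₚ : ∀ {m n} {Γ : Env m} {t L} {σ : Fin m → Term n} {D} → AllValue σ →
                  (ps : LamPremises Γ t L) (ds : D ⊢ˢ σ ∶ Γ) →
                  Premises (∑ₑ D) (sub (exts σ) t) L (sizeₚ ps + sizeˢ ds)
  substitutionₚ {D = D} σ-val none ds =
    premises _ none (sum-≈ε (Env-commutativeMonoid _) D (λ i → proj₁ (vanishes i)))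
      (sum-≈ε +-0-commutativeMonoid _ (λ i → proj₂ (vanishes i)))
    where
    vanishes : ∀ i → D i ≈E 𝟎ₑ _ × size (at ds i) ≡ 0
    vanishes i = invert-value-𝟎 (σ-val i) (conv (at ds i) ≈E.refl (≈P-reflexive (lookup-𝟎ₑ i)))
  substitutionₚ σ-val (more {P = P} d ps) ds with split-⊢ˢ σ-val ds
  ... | split-typings D₁ _ ds₁ ds₂ D≈ size≡
      with substitution (exts-value σ-val) d (exts-⊢ˢ P ds₁) | substitutionₚ σ-val ps ds₂
  ... | d' , d≡ | premises _ ps' Γ≈ ps≡ =
    premises _ (more (convₑ d' (∑ₑ-extsₑ P D₁)) ps') (≈E.trans D≈ (≈E.∙-congˡ Γ≈))
      (sym (+-interchange-parts (size d) (sizeₚ ps)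
              (trans d≡ (cong (size d +_) (sizeˢ-exts P ds₁))) (sym ps≡) size≡))

∑ₑ-↦ : ∀ {n} (Γ : Env n) → ∑ₑ (λ i → i ↦ lookup Γ i) ≈E Γ
∑ₑ-↦ []ᵥ      = []ₚ
∑ₑ-↦ (P ∷ᵥ Γ) = ≈E.trans (∑ₑ-extsₑ P (λ i → i ↦ lookup Γ i)) (≈P-refl ∷ₚ ∑ₑ-↦ Γ)

substitution₀ : ∀ {n} {Γ Δ : Env n} {t v P Q} → Value v → (d : (P ∷ᵥ Γ) ⊢ t ∶ Q) (dv : Δ ⊢ v ∶ P) →
                (Δ ⊎ₑ Γ) ⊢ t ⟪ v ⟫ ∶ Q ⟨ size d + size dv ⟩
substitution₀ {n} {Γ} {Δ} v-val d dv
  with substitution {D = Δ ∷ᶠ (λ i → i ↦ lookup Γ i)} (λ { zero → v-val ; (suc i) → var-val i }) d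
         (typings λ { zero → dv ; (suc i) → ax i (lookup Γ i) })
... | d' , size≡ =
  convₑ d' (≈E.∙-congˡ (∑ₑ-↦ Γ)) ,
  trans size≡ (cong (size d +_) (trans (cong (size dv +_) (ℕSum.sum-replicate-zero n)) (+-identityʳ (size dv))))

record AntiSubstitution {m n} (t : Term m) (σ : Fin m → Term n) (Γ : Env n) (Q : Pos) : Set where
  constructor preimage
  field
    Γ'      : Env m
    typing  : Γ' ⊢ t ∶ Q
    D       : Fin m → Env n
    σ-typing : D ⊢ˢ σ ∶ Γ'
    env≈    : Γ ≈E ∑ₑ D

mutual
  anti-substitution : ∀ {m n} {σ : Fin m → Term n} {Γ Q} → AllValue σ → (t : Term m) →
                      Γ ⊢ sub σ t ∶ Q → AntiSubstitution t σ Γ Q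
  anti-substitution {m} {n} {σ} {Γ} {Q} σ-val (var j) d =
    preimage (j ↦ Q) (ax j Q) D (typings ds)
      (≈E.sym (≈E.trans (sum-single (Env-commutativeMonoid n) D j D-elsewhere) (≈E.reflexive (updateAt-updates j _))))
    where
    -- σ j carries the whole environment; every other σ i is a value, typed by 𝟎 in 𝟎ₑ.
    D : Fin m → Env n
    D = updateAt (λ _ → 𝟎ₑ n) j (λ _ → Γ)
    D-elsewhere : ∀ i → i ≢ j → D i ≈E 𝟎ₑ n
    D-elsewhere i i≢j = ≈E.reflexive (updateAt-minimal i j _ i≢j)
    ds : ∀ i → D i ⊢ σ i ∶ lookup (j ↦ Q) i
    ds i with i ≟ j
    ... | yes refl = conv d (≈E.reflexive (sym (updateAt-updates j _))) (≈P-reflexive (sym (lookup-↦ j Q)))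
    ... | no i≢j   = conv (value-⊢𝟎 (σ-val i)) (≈E.reflexive (sym (updateAt-minimal i j _ i≢j)))
                          (≈P-reflexive (sym (lookup-↦-≢ Q i≢j)))
  anti-substitution σ-val (t · u) d with invert-app d
  ... | app-inversion _ _ _ d₁ d₂ Γ≈ _ with anti-substitution σ-val t d₁ | anti-substitution σ-val u d₂
  ... | preimage Γ₁ dt D₁ ds₁ Γ≈₁ | preimage Γ₂ du D₂ ds₂ Γ≈₂ =
    preimage (Γ₁ ⊎ₑ Γ₂) (app dt du) _ (merge-⊢ˢ σ-val ds₁ ds₂)
      (≈E.trans Γ≈ (≈E.trans (≈E.∙-cong Γ≈₁ Γ≈₂) (≈E.sym (EnvSum.∑-distrib-+ D₁ D₂))))
  anti-substitution σ-val (ƛ t) d with invert-lam d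
  ... | premises _ ps Γ≈ _ with anti-substitutionₚ σ-val t ps
  ... | preimage Γ' dλ D ds Γ≈' = preimage Γ' dλ D ds (≈E.trans Γ≈ Γ≈')

  anti-substitutionₚ : ∀ {m n} {σ : Fin m → Term n} {Γ L} → AllValue σ → (t : Term (suc m)) →
                       LamPremises Γ (sub (exts σ) t) L → AntiSubstitution (ƛ t) σ Γ L
  anti-substitutionₚ {m} {n} σ-val t none =
    preimage (𝟎ₑ m) (lam none) (λ _ → 𝟎ₑ n)
      (typings λ i → conv (value-⊢𝟎 (σ-val i)) ≈E.refl (≈P-reflexive (sym (lookup-𝟎ₑ i))))
      (≈E.sym (sum-≈ε (Env-commutativeMonoid n) {m} (λ _ → 𝟎ₑ n) (λ _ → ≈E.refl)))
  anti-substitutionₚ σ-val t (more d ps)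
    with anti-substitution (exts-value σ-val) t d | anti-substitutionₚ σ-val t ps
  ... | preimage (_ ∷ᵥ _) dt _ ds Γ≈ | preimage Γ₂ dλ D₂ ds₂ Γ≈₂ with exts-⊢ˢ⁻¹ ds
  ... | D₁ , ds₁ , D≈ with ≈E.trans Γ≈ D≈
  ... | P≈ ∷ₚ Γ≈₁ =
    preimage (_ ⊎ₑ Γ₂) (merge-value (lam-val t) (proj₁ (lam₁ (conv dt (≈P-sym P≈ ∷ₚ ≈E.refl) ≈P-refl))) dλ)
      _ (merge-⊢ˢ σ-val ds₁ ds₂) (≈E.trans (≈E.∙-cong Γ≈₁ Γ≈₂) (≈E.sym (EnvSum.∑-distrib-+ D₁ D₂)))

βv-expansion : ∀ {n} {Γ : Env n} {t v Q} → Value v → Γ ⊢ t ⟪ v ⟫ ∶ Q → Γ ⊢ (ƛ t) · v ∶ Q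
βv-expansion {t = t} v-val d with anti-substitution (λ { zero → v-val ; (suc i) → var-val i }) t d
... | preimage (_ ∷ᵥ Γ') dt D ds Γ≈ =
  convₑ (app (proj₁ (lam₁ dt)) (at ds zero)) (≈E.sym (≈E.trans Γ≈ (≈E.trans (≈E.∙-congˡ variables≈Γ') (≈E.comm _ _))))
  where
  variables≈Γ' : ∑ₑ (λ i → D (suc i)) ≈E Γ'
  variables≈Γ' =
    ≈E.trans (EnvSum.sum-cong-≋ {x = λ i → D (suc i)} (λ i → proj₁ (invert-var (at ds (suc i))))) (∑ₑ-↦ Γ')

βv-reduct : ∀ {n} {Γ : Env n} {t v Q} → Value v → (d : Γ ⊢ (ƛ t) · v ∶ Q) →
            Σ (Γ ⊢ t ⟪ v ⟫ ∶ Q) λ d' → size d' < size d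
βv-reduct v-val d with invert-redex d
... | redex-inversion Γ₁ Γ₂ _ body arg Γ≈ size≡ with substitution₀ v-val body arg
... | d' , d'≡ =
  convₑ d' (≈E.sym (≈E.trans Γ≈ (≈E.comm Γ₁ Γ₂))) , subst (size d' <_) (sym size≡) (s≤s (≤-reflexive d'≡))

-- Subject reduction and expansion

-- μ ≥ 2 everywhere (1<μ), which makes μ decrease strictly under σ₁ and σ₃.
μ : ∀ {n} → Term n → ℕ
μ (var _) = 2
μ (ƛ t)   = suc (μ t)
μ (t · u) = μ t * μ u

μ-rename : ∀ {m n} (ρ : Fin m → Fin n) t → μ (rename ρ t) ≡ μ t
μ-rename ρ (var i) = refl
μ-rename ρ (ƛ t)   = cong suc (μ-rename (ext ρ) t)
μ-rename ρ (t · u) = cong₂ _*_ (μ-rename ρ t) (μ-rename ρ u)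

1<μ : ∀ {n} (t : Term n) → 1 < μ t
1<μ (var _) = s≤s (s≤s z≤n)
1<μ (ƛ t)   = m<n⇒m<1+n (1<μ t)
1<μ (t · u) = ≤-trans (s≤s (s≤s z≤n)) (*-mono-≤ (1<μ t) (1<μ u))

μ-nonZero : ∀ {n} (t : Term n) → NonZero (μ t)
μ-nonZero t = >-nonZero (<⇒≤ (1<μ t))

suc-*-< : ∀ a b .{{_ : NonZero b}} c → 1 < c → suc (a * c) * b < suc a * b * c
suc-*-< a b c 1<c = begin-strict
  suc (a * c) * b    ≡⟨ expandˡ a b c ⟩
  b + a * c * b      <⟨ +-monoˡ-< (a * c * b) (m<m*n b c 1<c) ⟩
  b * c + a * c * b  ≡⟨ expandʳ a b c ⟩
  suc a * b * c      ∎
  where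
  open ≤-Reasoning
  expandˡ : ∀ a b c → suc (a * c) * b ≡ b + a * c * b
  expandˡ = solve-∀
  expandʳ : ∀ a b c → b * c + a * c * b ≡ suc a * b * c
  expandʳ = solve-∀

μ-σ₁ : ∀ {n} (t : Term (suc n)) (u s : Term n) → μ ((ƛ (t · weaken s)) · u) < μ ((ƛ t) · u · s)
μ-σ₁ t u s rewrite μ-rename suc s = suc-*-< (μ t) (μ u) {{μ-nonZero u}} (μ s) (1<μ s)

μ-σ₃ : ∀ {n} (v u : Term n) (s : Term (suc n)) → μ ((ƛ (weaken v · s)) · u) < μ (v · ((ƛ s) · u))
μ-σ₃ v u s rewrite μ-rename suc v | *-comm (μ v) (μ s) | *-comm (μ v) (suc (μ s) * μ u) =
  suc-*-< (μ s) (μ u) {{μ-nonZero u}} (μ v) (1<μ v)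

σ₁-reduct : ∀ {n} {Γ : Env n} {t u s Q} (d : Γ ⊢ (ƛ t) · u · s ∶ Q) →
            Γ ⊢ (ƛ (t · weaken s)) · u ∶ Q ⟨ size d ⟩
σ₁-reduct d with invert-app d
... | app-inversion _ Γs _ dr ds Γ≈ size≡ with invert-redex dr
... | redex-inversion Γt Γu C body du Γ≈' size≡' with weaken-⊢₀ ds
... | ds' , ds'≡ with redex (convₑ (app body ds') (≈P-reflexive (++-identityʳ C) ∷ₚ ≈E.refl)) du
... | d' , d'≡ =
  convₑ d' (≈E.sym (≈E.trans Γ≈ (≈E.trans (≈E.∙-congʳ Γ≈') (≈E.xy∙z≈xz∙y Γt Γu Γs)))) , (begin
    size d'                                       ≡⟨ d'≡ ⟩
    suc (suc (size body + size ds') + size du)    ≡⟨ cong (λ k → suc (suc (size body + k) + size du)) ds'≡ ⟩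
    suc (suc (size body + size ds) + size du)     ≡⟨ cong (suc ∘′ suc) (+-CS.xy∙z≈xz∙y (size body) (size ds) (size du)) ⟩
    suc (suc (size body + size du) + size ds)     ≡⟨ cong (λ k → suc (k + size ds)) (sym size≡') ⟩
    suc (size dr + size ds)                       ≡⟨ sym size≡ ⟩
    size d                                        ∎)
  where open ≡-Reasoning

σ₃-reduct : ∀ {n} {Γ : Env n} {v u s Q} (d : Γ ⊢ v · ((ƛ s) · u) ∶ Q) →
            Γ ⊢ (ƛ (weaken v · s)) · u ∶ Q ⟨ size d ⟩
σ₃-reduct d with invert-app d
... | app-inversion Γv _ _ dv dr Γ≈ size≡ with invert-redex dr
... | redex-inversion Γs Γu C body du Γ≈' size≡' with weaken-⊢₀ dv
... | dv' , dv'≡ with redex (app dv' body) du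
... | d' , d'≡ =
  convₑ d' (≈E.sym (≈E.trans Γ≈ (≈E.trans (≈E.∙-congˡ Γ≈') (≈E.sym (≈E.assoc Γv Γs Γu))))) , (begin
    size d'                                       ≡⟨ d'≡ ⟩
    suc (suc (size dv' + size body) + size du)    ≡⟨ cong (λ k → suc (suc (k + size body) + size du)) dv'≡ ⟩
    suc (suc (size dv + size body) + size du)     ≡⟨ cong (suc ∘′ suc) (+-assoc (size dv) (size body) (size du)) ⟩
    suc (suc (size dv + (size body + size du)))   ≡⟨ cong suc (sym (+-suc (size dv) (size body + size du))) ⟩
    suc (size dv + suc (size body + size du))     ≡⟨ cong (λ k → suc (size dv + k)) (sym size≡') ⟩
    suc (size dv + size dr)                       ≡⟨ sym size≡ ⟩
    size d                                        ∎)
  where open ≡-Reasoning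

σ₁-expansion : ∀ {n} {Γ : Env n} {t u s Q} → Γ ⊢ (ƛ (t · weaken s)) · u ∶ Q → Γ ⊢ (ƛ t) · u · s ∶ Q
σ₁-expansion {s = s} d with invert-redex d
... | redex-inversion Γb Γu C body du Γ≈ _ with invert-app body
... | app-inversion (C' ∷ᵥ Γt) _ _ dt dws Γ≈' _ with strengthen-⊢₀ s dws
... | Γs , ds , Γ≈s with ≈E.trans Γ≈' (≈E.∙-congˡ Γ≈s)
... | C≈ ∷ₚ Γb≈ =
  convₑ (app (proj₁ (redex (conv dt (C'≈C ∷ₚ ≈E.refl) ≈P-refl) du)) ds)
    (≈E.sym (≈E.trans Γ≈ (≈E.trans (≈E.∙-congʳ Γb≈) (≈E.xy∙z≈xz∙y Γt Γs Γu))))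
  where
  C'≈C : C' ≈P C
  C'≈C = trans≈ (≈P-sym (≈P-reflexive (++-identityʳ C'))) (≈P-sym C≈)

σ₃-expansion : ∀ {n} {Γ : Env n} {v u s Q} → Γ ⊢ (ƛ (weaken v · s)) · u ∶ Q → Γ ⊢ v · ((ƛ s) · u) ∶ Q
σ₃-expansion {v = v} d with invert-redex d
... | redex-inversion Γb Γu C body du Γ≈ _ with invert-app body
... | app-inversion _ (C' ∷ᵥ Γs) _ dwv ds Γ≈' _ with strengthen-⊢₀ v dwv
... | Γv , dv , Γ≈v with ≈E.trans Γ≈' (≈E.∙-congʳ Γ≈v)
... | C≈ ∷ₚ Γb≈ =
  convₑ (app dv (proj₁ (redex (conv ds (≈P-sym C≈ ∷ₚ ≈E.refl) ≈P-refl) du)))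
    (≈E.sym (≈E.trans Γ≈ (≈E.trans (≈E.∙-congʳ Γb≈) (≈E.assoc Γv Γs Γu))))

infix 4 _<ₗₑₓ_

_<ₗₑₓ_ : ℕ × ℕ → ℕ × ℕ → Set
_<ₗₑₓ_ = ×-Lex _≡_ _<_ _<_

<ₗₑₓ-wellFounded : WellFounded _<ₗₑₓ_
<ₗₑₓ-wellFounded = ×-wellFounded <-wellFounded <-wellFounded

<ₗₑₓ-map : ∀ {f g : ℕ → ℕ} → (∀ {x y} → x < y → f x < f y) → (∀ {x y} → x < y → g x < g y) →
           ∀ {a b a' b'} → (a' , b') <ₗₑₓ (a , b) → (f a' , g b') <ₗₑₓ (f a , g b)
<ₗₑₓ-map f-mono g-mono (inj₁ a'<a)         = inj₁ (f-mono a'<a)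
<ₗₑₓ-map f-mono g-mono (inj₂ (a'≡a , b'<b)) = inj₂ (cong _ a'≡a , g-mono b'<b)

subject-reduction : ∀ {n} {Γ : Env n} {t t' Q} → t ⟶ t' → (d : Γ ⊢ t ∶ Q) →
                    Σ (Γ ⊢ t' ∶ Q) λ d' → (size d' , μ t') <ₗₑₓ (size d , μ t)
subject-reduction (βv v-val) d with βv-reduct v-val d
... | d' , d'<d = d' , inj₁ d'<d
subject-reduction {t = (ƛ t) · u · s} σ₁ d with σ₁-reduct d
... | d' , d'≡d = d' , inj₂ (d'≡d , μ-σ₁ t u s)
subject-reduction {t = v · ((ƛ s) · u)} (σ₃ _) d with σ₃-reduct d
... | d' , d'≡d = d' , inj₂ (d'≡d , μ-σ₃ v u s)
subject-reduction {t = (ƛ t) · u} (ξ-λ r) d with invert-redex d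
... | redex-inversion _ _ _ body arg Γ≈ size≡ with subject-reduction r body
... | body' , lt with redex body' arg
... | d' , d'≡ =
  convₑ d' (≈E.sym Γ≈) ,
  subst₂ (λ k k' → (k , _) <ₗₑₓ (k' , μ ((ƛ t) · u))) (sym d'≡) (sym size≡)
    (<ₗₑₓ-map (λ x<y → s≤s (+-monoˡ-< (size arg) x<y)) (*-monoˡ-< (μ u) {{μ-nonZero u}} ∘ s≤s) lt)
subject-reduction {t = t · u} (ξ-appL r) d with invert-app d
... | app-inversion _ _ _ fun arg Γ≈ size≡ with subject-reduction r fun
... | fun' , lt =
  convₑ (app fun' arg) (≈E.sym Γ≈) ,
  subst (λ k → (_ , _) <ₗₑₓ (k , μ (t · u))) (sym size≡)
    (<ₗₑₓ-map (λ x<y → s≤s (+-monoˡ-< (size arg) x<y)) (*-monoˡ-< (μ u) {{μ-nonZero u}}) lt)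
subject-reduction {t = t · u} (ξ-appR r) d with invert-app d
... | app-inversion _ _ _ fun arg Γ≈ size≡ with subject-reduction r arg
... | arg' , lt =
  convₑ (app fun arg') (≈E.sym Γ≈) ,
  subst (λ k → (_ , _) <ₗₑₓ (k , μ (t · u))) (sym size≡)
    (<ₗₑₓ-map (λ x<y → s≤s (+-monoʳ-< (size fun) x<y)) (*-monoʳ-< (μ t) {{μ-nonZero t}}) lt)

subject-expansion : ∀ {n} {Γ : Env n} {t t' Q} → t ⟶ t' → Γ ⊢ t' ∶ Q → Γ ⊢ t ∶ Q
subject-expansion (βv v-val) d = βv-expansion v-val d
subject-expansion σ₁         d = σ₁-expansion d
subject-expansion (σ₃ _)     d = σ₃-expansion d
subject-expansion (ξ-λ r) d with invert-redex d
... | redex-inversion _ _ _ body arg Γ≈ _ = convₑ (proj₁ (redex (subject-expansion r body) arg)) (≈E.sym Γ≈)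
subject-expansion (ξ-appL r) d with invert-app d
... | app-inversion _ _ _ fun arg Γ≈ _ = convₑ (app (subject-expansion r fun) arg) (≈E.sym Γ≈)
subject-expansion (ξ-appR r) d with invert-app d
... | app-inversion _ _ _ fun arg Γ≈ _ = convₑ (app fun (subject-expansion r arg)) (≈E.sym Γ≈)

subject-reduction* : ∀ {n} {Γ : Env n} {t t' Q} → t ⟶* t' → Γ ⊢ t ∶ Q → Γ ⊢ t' ∶ Q
subject-reduction* Star.ε   d = d
subject-reduction* (r ◅ rs) d = subject-reduction* rs (proj₁ (subject-reduction r d))

subject-expansion* : ∀ {n} {Γ : Env n} {t t' Q} → t ⟶* t' → Γ ⊢ t' ∶ Q → Γ ⊢ t ∶ Q
subject-expansion* Star.ε   d = d
subject-expansion* (r ◅ rs) d = subject-expansion r (subject-expansion* rs d)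

-- Normalization

Reducible : ∀ {n} → Term n → Set
Reducible t = ∃ λ t' → t ⟶ t'

mutual
  progress : ∀ {n} (t : Term n) → Reducible t ⊎ Normal t
  progress (var i) = inj₂ λ _ ()
  progress (ƛ t)   = inj₂ λ _ ()
  progress (t · u) with progress t | progress u
  ... | inj₁ (_ , r) | _            = inj₁ (_ , ξ-appL r)
  ... | inj₂ _       | inj₁ (_ , r) = inj₁ (_ , ξ-appR r)
  ... | inj₂ t-nf    | inj₂ u-nf    = progress-· t u t-nf u-nf

  progress-· : ∀ {n} (t u : Term n) → Normal t → Normal u → Reducible (t · u) ⊎ Normal (t · u)
  progress-· ((ƛ _) · _) u _ _ = inj₁ (_ , σ₁)
  progress-· (ƛ b) u t-nf u-nf with progress b
  ... | inj₁ (_ , r) = inj₁ (_ , ξ-λ r)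
  progress-· (ƛ b) (var j)       _    _    | inj₂ _    = inj₁ (_ , βv (var-val j))
  progress-· (ƛ b) (ƛ s)         _    _    | inj₂ _    = inj₁ (_ , βv (lam-val s))
  progress-· (ƛ b) ((ƛ _) · _)   _    _    | inj₂ _    = inj₁ (_ , σ₃ (lam-val b))
  progress-· (ƛ b) (var _ · _)   t-nf u-nf | inj₂ b-nf =
    inj₂ λ { _ (ξ-λ r) → b-nf _ r ; _ (ξ-appL r) → t-nf _ r ; _ (ξ-appR r) → u-nf _ r }
  progress-· (ƛ b) ((_ · _) · _) t-nf u-nf | inj₂ b-nf =
    inj₂ λ { _ (ξ-λ r) → b-nf _ r ; _ (ξ-appL r) → t-nf _ r ; _ (ξ-appR r) → u-nf _ r }
  progress-· (var i) ((ƛ _) · _)   _    _    = inj₁ (_ , σ₃ (var-val i))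
  progress-· (var i) (var _)       t-nf u-nf = inj₂ λ { _ (ξ-appL r) → t-nf _ r ; _ (ξ-appR r) → u-nf _ r }
  progress-· (var i) (ƛ _)         t-nf u-nf = inj₂ λ { _ (ξ-appL r) → t-nf _ r ; _ (ξ-appR r) → u-nf _ r }
  progress-· (var i) (var _ · _)   t-nf u-nf = inj₂ λ { _ (ξ-appL r) → t-nf _ r ; _ (ξ-appR r) → u-nf _ r }
  progress-· (var i) ((_ · _) · _) t-nf u-nf = inj₂ λ { _ (ξ-appL r) → t-nf _ r ; _ (ξ-appR r) → u-nf _ r }
  progress-· (var _ · _)   u t-nf u-nf = inj₂ λ { _ (ξ-appL r) → t-nf _ r ; _ (ξ-appR r) → u-nf _ r }
  progress-· ((_ · _) · _) u t-nf u-nf = inj₂ λ { _ (ξ-appL r) → t-nf _ r ; _ (ξ-appR r) → u-nf _ r }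

normalizable-from-acc : ∀ {n} {Γ : Env n} {t Q} (d : Γ ⊢ t ∶ Q) → Acc _<ₗₑₓ_ (size d , μ t) → Normalizable t
normalizable-from-acc {t = t} d (acc smaller) with progress t
... | inj₂ t-nf = t , Star.ε , t-nf
... | inj₁ (_ , r) with subject-reduction r d
... | d' , d'<d with normalizable-from-acc d' (smaller d'<d)
... | t'' , rs , t''-nf = t'' , r ◅ rs , t''-nf

typable⇒normalizable : ∀ {n} {Γ : Env n} {t Q} → Γ ⊢ t ∶ Q → Normalizable t
typable⇒normalizable d = normalizable-from-acc d (<ₗₑₓ-wellFounded _)

normal-𝟎ₑ⇒value : ∀ {n} {Γ : Env n} {t Q} → Normal t → Γ ⊢ t ∶ Q → Γ ≈E 𝟎ₑ n → Value t
normal-𝟎ₑ⇒value {t = var i} _ _ _ = var-val i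
normal-𝟎ₑ⇒value {t = ƛ t}   _ _ _ = lam-val t
normal-𝟎ₑ⇒value {t = t · u} t-nf d Γ≈𝟎 with invert-app d
... | app-inversion _ _ _ fun arg Γ≈ _ with ⊎ₑ-conical (≈E.trans (≈E.sym Γ≈) Γ≈𝟎)
... | fun-𝟎 , arg-𝟎 with t
... | var i = ⊥-elim (↦-≉𝟎ₑ i (≈E.trans (≈E.sym (proj₁ (invert-var fun))) fun-𝟎))
... | ƛ b   = ⊥-elim (t-nf _ (βv (normal-𝟎ₑ⇒value (λ _ r → t-nf _ (ξ-appR r)) arg arg-𝟎)))
... | _ · _ with normal-𝟎ₑ⇒value (λ _ r → t-nf _ (ξ-appL r)) fun fun-𝟎
... | ()

NormalizesToValue : ∀ {n} → Term n → Set
NormalizesToValue {n} t = Normalizable t × (∀ (t' : Term n) → t ⟶* t' → Normal t' → Value t')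

normalizes-to-value⇒⊢𝟎 : ∀ {n} {t : Term n} → NormalizesToValue t → 𝟎ₑ n ⊢ t ∶ 𝟎
normalizes-to-value⇒⊢𝟎 ((t' , rs , t'-nf) , values) = subject-expansion* rs (value-⊢𝟎 (values t' rs t'-nf))

⊢𝟎⇒normalizes-to-value : ∀ {n} {t : Term n} → 𝟎ₑ n ⊢ t ∶ 𝟎 → NormalizesToValue t
⊢𝟎⇒normalizes-to-value d =
  typable⇒normalizable d , λ t' rs t'-nf → normal-𝟎ₑ⇒value t'-nf (subject-reduction* rs d) ≈E.refl

proposition4p6 : ∀ {k : ℕ} (t : Term k) →
    ((Normalizable t × (∀ (t' : Term k) → t ⟶* t' → Normal t' → Value t'))
    ⇔ ⟦ t ⟧ (𝟎ₑ k , 𝟎))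
    × (⟦ t ⟧ (𝟎ₑ k , 𝟎) ⇔ (𝟎ₑ k ⊢ t ∶ 𝟎))
proposition4p6 t = mk⇔ normalizes-to-value⇒⊢𝟎 ⊢𝟎⇒normalizes-to-value , mk⇔ id id
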